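{- Let $\ell\ge 1$ be an integer and $n=2^\ell+2$. Let $G_\ell$ be the graph on vertices $v_1,\dots,v_n$ in which, for $0\le k\le \ell$ and $1\le i\le n-2^k$, the pair $v_iv_{i+2^k}$ is an edge if and only if $i-1$ or $i-2$ is a multiple of $2^k$ (for $k=0$ this gives the path $v_1v_2\cdots v_n$). Consider a plane straight-line embedding of $G_\ell$ in which the $x$-coordinates satisfy $x(v_1)<x(v_2)<\dots<x(v_n)$. Then the number of $x$-monotone paths in $G_\ell$ is $\Omega(1.7003^n)$ as $\ell\to\infty$.
   Context: A plane straight-line graph is a graph whose vertices are points in the plane and whose edges are straight segments between their endpoints, no two of which intersect except at common endpoints. A polygonal path $(w_1,\dots,w_t)$ is monotone in direction $\mathbf{u}\neq\mathbf{0}$ if $\langle \overrightarrow{w_iw_{i+1}},\mathbf{u}\rangle>0$ for all $i$; it is $x$-monotone if it is monotone in direction $(1,0)$.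
   Formalization: The embedding of $G_\ell$ places its vertices at points with rational coordinates instead of arbitrary points in the plane. -}

module Defs where

open import Data.Bool using (Bool; true; false; _∧_; _∨_; T)
open import Data.Nat as ℕ using (ℕ; zero; suc; _+_; _∸_; _^_; _≡ᵇ_; _≤ᵇ_)
open import Data.Nat.Divisibility using (_∣?_)
open import Data.Fin using (Fin; toℕ)
open import Data.List using (List; []; _∷_; map; concatMap; length; filterᵇ; allFin)
open import Data.Bool.ListAction using (any)
open import Data.Product using (_×_; _,_; proj₁; proj₂; Σ; ∃)
open import Data.Sum using (_⊎_)
open import Data.Rational as ℚ using (ℚ; 0ℚ; 1ℚ)
open import Data.Rational.Properties using (_<?_)
open import Relation.Nullary using (¬_; does)
open import Relation.Binary.PropositionalEquality using (_≡_)

nV : ℕ → ℕ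
nV ℓ = 2 ^ ℓ + 2

-- Vertices v_1,…,v_n are represented by Fin (nV ℓ); vertex v_{a+1} is the
-- element with toℕ = a (0-based index a = i - 1).  With a = i-1: 2^k ∣ a, or (a ≥ 1 and 2^k ∣ a-1).
-- (i-2 = -1 for i = 1 is a multiple of 2^k only for k = 0, where 2^0 ∣ a anyway.)
edgeAt : ℕ → ℕ → ℕ → Bool
edgeAt a b k =
  (b ≡ᵇ a + 2 ^ k) ∧ (does (2 ^ k ∣? a) ∨ ((1 ≤ᵇ a) ∧ does (2 ^ k ∣? (a ∸ 1))))

edgeᵇ : (ℓ : ℕ) → Fin (nV ℓ) → Fin (nV ℓ) → Bool
edgeᵇ ℓ u v = any (λ k → edgeAt (toℕ u) (toℕ v) (toℕ k)) (allFin (suc ℓ))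

adjᵇ : (ℓ : ℕ) → Fin (nV ℓ) → Fin (nV ℓ) → Bool
adjᵇ ℓ u v = edgeᵇ ℓ u v ∨ edgeᵇ ℓ v u

Point : Set
Point = ℚ × ℚ

xc : Point → ℚ
xc = proj₁

OnSeg : Point → Point → Point → Set
OnSeg p a b = Σ ℚ λ t → (0ℚ ℚ.≤ t) × (t ℚ.≤ 1ℚ) ×
  (proj₁ p ≡ proj₁ a ℚ.+ t ℚ.* (proj₁ b ℚ.- proj₁ a)) ×
  (proj₂ p ≡ proj₂ a ℚ.+ t ℚ.* (proj₂ b ℚ.- proj₂ a))

IsXOrderedPlaneEmbedding : (ℓ : ℕ) → (Fin (nV ℓ) → Point) → Set
IsXOrderedPlaneEmbedding ℓ pos =
  (∀ (i j : Fin (nV ℓ)) → toℕ i ℕ.< toℕ j → xc (pos i) ℚ.< xc (pos j)) ×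
  (∀ (a b c d : Fin (nV ℓ)) → T (edgeᵇ ℓ a b) → T (edgeᵇ ℓ c d) →
     ¬ (a ≡ c × b ≡ d) →
     ∀ (p : Point) → OnSeg p (pos a) (pos b) → OnSeg p (pos c) (pos d) →
     Σ (Fin (nV ℓ)) λ w → (w ≡ a ⊎ w ≡ b) × (w ≡ c ⊎ w ≡ d) × (p ≡ pos w))

listsOfLength : (m k : ℕ) → List (List (Fin m))
listsOfLength m zero = [] ∷ []
listsOfLength m (suc k) = concatMap (λ v → map (v ∷_) (listsOfLength m k)) (allFin m)

-- all lists of length 2 … m+1 over Fin m (every path w_1…w_t with t ≥ 2 and
-- distinct vertices has t ≤ m; longer lists are harmless, they are never paths)
candidates : (m : ℕ) → List (List (Fin m))
candidates m = concatMap (λ k → listsOfLength m (suc (suc (toℕ k)))) (allFin m)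

isMonotonePathᵇ : (ℓ : ℕ) → (Fin (nV ℓ) → Point) → List (Fin (nV ℓ)) → Bool
isMonotonePathᵇ ℓ pos [] = false
isMonotonePathᵇ ℓ pos (w ∷ []) = true
isMonotonePathᵇ ℓ pos (w ∷ w′ ∷ ws) =
  adjᵇ ℓ w w′ ∧ does (xc (pos w′) ℚ.- xc (pos w) ℚ.>? 0ℚ) ∧ isMonotonePathᵇ ℓ pos (w′ ∷ ws)
  where open import Data.Rational.Properties using (_>?_)

countMonotonePaths : (ℓ : ℕ) → (Fin (nV ℓ) → Point) → ℕ
countMonotonePaths ℓ pos = length (filterᵇ (isMonotonePathᵇ ℓ pos) (candidates (nV ℓ)))

_^ℚ_ : ℚ → ℕ → ℚ
q ^ℚ zero = 1ℚ
q ^ℚ suc k = q ℚ.* (q ^ℚ k)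

base : ℚ
base = ℤ.+ 17003 ℚ./ 10000
  where import Data.Integer as ℤ

ℕtoℚ : ℕ → ℚ
ℕtoℚ m = ℤ.+ m ℚ./ 1
  where import Data.Integer as ℤ

module Submission where

-- Number the vertices 0, …, 2^ℓ + 1.  A path with increasing indices is x-monotone, and it suffices to count such paths.  Cut the vertices
-- into blocks of width 2^(d+1) and let M_d a b count the paths from vertex a ∈ {0,1} of a block that
-- enter the next block at its vertex b ∈ {0,1}.  Such a path either enters the second half of its
-- block at a vertex m ∈ {0,1} of it, and then splits into two paths of the half-blocks, or it ends
-- with one of the new longest edges.  Hence M_{d+1} ≥ M_d² entrywise, and the vector v = (16, 9),
-- for which M_4 v ≥ 1.7003^32 v by evaluation, gives M_d v ≥ 1.7003^(2^(d+1)) v.  For ℓ = d + 1 the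
-- first row of M_d counts paths from v₁ to the last two vertices.

open import Defs

open import Data.Bool using (Bool; true; false; T; _∧_)
open import Data.Bool.ListAction using (any)
open import Data.Bool.Properties using (T-∧; T-∨)
open import Data.Empty using (⊥-elim)
open import Data.Fin using (Fin; toℕ; fromℕ<)
open import Data.Fin.Properties using (toℕ-fromℕ<)
open import Data.List using (List; []; _∷_; _++_; [_]; _∷ʳ_; map; length; head; cartesianProductWith; filterᵇ; allFin)
open import Data.List.Properties
  using (map-∘; map-id-local; length-++; length-map; map-injective; ∷-injective; ∷ʳ-injective; ++-assoc; map-++)
open import Data.List.Membership.Propositional using (_∈_; lose)
open import Data.List.Membership.Propositional.Properties
  using (∈-map⁻; ∈-map⁺; ∈-++⁻; ∈-++⁺ˡ; ∈-++⁺ʳ; ∈-∃++; ∈-allFin; ∈-concatMap⁺; ∈-filter⁺; ∈-cartesianProductWith⁻)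
open import Data.List.Relation.Unary.All as All using (All; []; _∷_)
import Data.List.Relation.Unary.All.Properties as All
open import Data.List.Relation.Unary.Any using (here; there)
open import Data.List.Relation.Unary.Any.Properties using (any⁺)
open import Data.List.Relation.Unary.Linked as Linked using (Linked; []; [-]; _∷_)
import Data.List.Relation.Unary.Linked.Properties as Linked
open import Data.List.Relation.Unary.Unique.Propositional using (Unique; []; _∷_)
import Data.List.Relation.Unary.Unique.Propositional.Properties as Unique
open import Data.Maybe using (just)
open import Data.Nat
open import Data.Nat.Divisibility using (_∣_; _∣?_; ∣-refl; ∣-trans; ∣m∣n⇒∣m+n; m∣m*n; divides)
open import Data.Nat.Properties
open import Data.Nat.DivMod using (_mod_; m%n<n; m<n⇒m%n≡m)
open import Data.Nat.Tactic.RingSolver using (solve-∀)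
open import Data.Product using (Σ; ∃₂; _×_; _,_; proj₁; proj₂)
open import Data.Sum using (_⊎_; inj₁; inj₂)
open import Function using (_∘′_)
open import Data.Unit using (tt)
import Data.Integer as ℤ
import Data.Integer.Properties as ℤ
open import Data.Rational as ℚ using (ℚ; 0ℚ; toℚᵘ)
open import Data.Rational.Unnormalised as ℚᵘ using (ℚᵘ; mkℚᵘ; ↥_; ↧_; ↧ₙ_; *≤*)
import Data.Rational.Unnormalised.Properties as ℚᵘ
import Data.Rational.Properties as ℚ
open import Function.Bundles using (Equivalence)
open import Relation.Nullary using (¬_; Dec; does)
open import Relation.Nullary.Decidable using (dec-true)
open import Relation.Binary.PropositionalEquality hiding ([_])

private variable
  A B C : Set

length-cartesianProductWith : (f : A → B → C) (xs : List A) (ys : List B) →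
  length (cartesianProductWith f xs ys) ≡ length xs * length ys
length-cartesianProductWith f []       ys = refl
length-cartesianProductWith f (x ∷ xs) ys = begin
  length (map (f x) ys ++ cartesianProductWith f xs ys)
    ≡⟨ length-++ (map (f x) ys) ⟩
  length (map (f x) ys) + length (cartesianProductWith f xs ys)
    ≡⟨ cong₂ _+_ (length-map (f x) ys) (length-cartesianProductWith f xs ys) ⟩
  length ys + length xs * length ys ∎
  where open ≡-Reasoning

Unique-cartesianProductWith⁺ : (f : A → B → C) {xs : List A} {ys : List B} →
  (∀ {w x y z} → w ∈ xs → x ∈ xs → f w y ≡ f x z → w ≡ x × y ≡ z) →
  Unique xs → Unique ys → Unique (cartesianProductWith f xs ys)
Unique-cartesianProductWith⁺ f inj [] ys! = []
Unique-cartesianProductWith⁺ f {x ∷ xs} {ys} inj (x∉xs ∷ xs!) ys! =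
  Unique.++⁺ (Unique.map⁺ (λ e → proj₂ (inj (here refl) (here refl) e)) ys!)
             (Unique-cartesianProductWith⁺ f (λ w∈ x∈ → inj (there w∈) (there x∈)) xs! ys!)
             disjoint
  where
  disjoint : ∀ {v} → ¬ (v ∈ map (f x) ys × v ∈ cartesianProductWith f xs ys)
  disjoint (v∈map , v∈prod) with ∈-map⁻ (f x) v∈map | ∈-cartesianProductWith⁻ f xs ys v∈prod
  ... | _ , _ , refl | x′ , _ , x′∈xs , _ , e with inj (here refl) (there x′∈xs) e
  ... | refl , _ = All.lookup x∉xs x′∈xs refl

Unique-⊆⇒length≤ : {xs ys : List A} → Unique xs → (∀ {x} → x ∈ xs → x ∈ ys) → length xs ≤ length ys
Unique-⊆⇒length≤ {xs = []} _ _ = z≤n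
Unique-⊆⇒length≤ {xs = x ∷ xs} {ys} (x∉xs ∷ xs!) xs⊆ys with ∈-∃++ (xs⊆ys (here refl))
... | ys₁ , ys₂ , refl = begin
  suc (length xs)               ≤⟨ s≤s (Unique-⊆⇒length≤ xs! xs⊆ys₁ys₂) ⟩
  suc (length (ys₁ ++ ys₂))     ≡⟨ cong suc (length-++ ys₁) ⟩
  suc (length ys₁ + length ys₂) ≡⟨ +-suc (length ys₁) (length ys₂) ⟨
  length ys₁ + length (x ∷ ys₂) ≡⟨ length-++ ys₁ ⟨
  length (ys₁ ++ x ∷ ys₂)       ∎
  where
  open ≤-Reasoning
  xs⊆ys₁ys₂ : ∀ {y} → y ∈ xs → y ∈ ys₁ ++ ys₂
  xs⊆ys₁ys₂ y∈xs with ∈-++⁻ ys₁ (xs⊆ys (there y∈xs))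
  ... | inj₁ y∈ys₁         = ∈-++⁺ˡ y∈ys₁
  ... | inj₂ (here refl)   = ⊥-elim (All.lookup x∉xs y∈xs refl)
  ... | inj₂ (there y∈ys₂) = ∈-++⁺ʳ ys₁ y∈ys₂

Linked-join : {R : A → A → Set} (xs : List A) {x : A} {ys : List A} →
  Linked R (xs ∷ʳ x) → Linked R (x ∷ ys) → Linked R (xs ++ x ∷ ys)
Linked-join []           _          x∷ys = x∷ys
Linked-join (_ ∷ [])     (r ∷ _)    x∷ys = r ∷ x∷ys
Linked-join (_ ∷ y ∷ xs) (r ∷ rxs)  x∷ys = r ∷ Linked-join (y ∷ xs) rxs x∷ys

m^n∣m^o : ∀ m {n o} → n ≤ o → m ^ n ∣ m ^ o
m^n∣m^o m {n} {o} n≤o = subst (λ k → m ^ n ∣ m ^ k) (m+[n∸m]≡n n≤o)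
  (subst (m ^ n ∣_) (sym (^-distribˡ-+-* m n (o ∸ n))) (m∣m*n (m ^ (o ∸ n))))

++-map-+-injective : ∀ {n} p p′ {q q′} → All (_< n) p → All (_< n) p′ →
  p ++ map (n +_) q ≡ p′ ++ map (n +_) q′ → p ≡ p′ × q ≡ q′
++-map-+-injective {n} [] [] _ _ e = refl , map-injective (+-cancelˡ-≡ n _ _) e
++-map-+-injective {n} [] (x ∷ p′) {y ∷ q} _ (x<n ∷ _) e =
  ⊥-elim (<⇒≱ x<n (subst (n ≤_) (proj₁ (∷-injective e)) (m≤m+n n y)))
++-map-+-injective {n} (x ∷ p) [] {q′ = y ∷ q′} (x<n ∷ _) _ e =
  ⊥-elim (<⇒≱ x<n (subst (n ≤_) (sym (proj₁ (∷-injective e))) (m≤m+n n y)))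
++-map-+-injective (x ∷ p) (x′ ∷ p′) (_ ∷ p<n) (_ ∷ p′<n) e with ∷-injective e
... | refl , e′ with ++-map-+-injective p p′ p<n p′<n e′
... | refl , refl = refl , refl

bit : Bool → ℕ
bit false = 0
bit true  = 1

width : ℕ → ℕ
width d = 2 ^ suc d

width-suc : ∀ d → width (suc d) ≡ width d + width d
width-suc d = cong (width d +_) (+-identityʳ (width d))

2≤width : ∀ d → 2 ≤ width d
2≤width d = *-monoʳ-≤ 2 (m^n>0 2 d)

data Source (j : ℕ) : ℕ → Set where
  aligned  : ∀ {x} → 2 ^ j ∣ x → Source j x
  aligned′ : ∀ {x} → 2 ^ j ∣ x → Source j (suc x)

data Edge (L : ℕ) : ℕ → ℕ → Set where
  edge : ∀ {j x} → j ≤ L → Source j x → Edge L x (x + 2 ^ j)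

Edge⇒< : ∀ {L x y} → Edge L x y → x < y
Edge⇒< (edge {j} {x} _ _) = m<m+n x (m^n>0 2 j)

Edge-mono : ∀ {L M x y} → L ≤ M → Edge L x y → Edge M x y
Edge-mono L≤M (edge j≤L s) = edge (≤-trans j≤L L≤M) s

Source-shift : ∀ {j x} s → 2 ^ j ∣ s → Source j x → Source j (s + x)
Source-shift s j∣s (aligned j∣x)          = aligned (∣m∣n⇒∣m+n j∣s j∣x)
Source-shift {x = suc x} s j∣s (aligned′ j∣x) =
  subst (Source _) (sym (+-suc s x)) (aligned′ (∣m∣n⇒∣m+n j∣s j∣x))

Edge-shift : ∀ {L x y} s → 2 ^ L ∣ s → Edge L x y → Edge L (s + x) (s + y)
Edge-shift {L} s L∣s (edge {j} {x} j≤L src) =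
  subst (Edge L (s + x)) (+-assoc s x (2 ^ j))
    (edge j≤L (Source-shift s (∣-trans (m^n∣m^o 2 j≤L) L∣s) src))

Linked-shift : ∀ {L xs} s → 2 ^ L ∣ s → Linked (Edge L) xs → Linked (Edge L) (map (s +_) xs)
Linked-shift s L∣s = Linked.map⁺ ∘′ Linked.map (Edge-shift s L∣s)

joinAt : ℕ → List ℕ → List ℕ → List ℕ
joinAt n p q = p ++ map (n +_) q

joinAt-∷ʳ : ∀ n p x q y → joinAt n p (x ∷ q) ∷ʳ (n + y) ≡ p ++ n + x ∷ map (n +_) (q ∷ʳ y)
joinAt-∷ʳ n p x q y = begin
  (p ++ n + x ∷ map (n +_) q) ++ [ n + y ] ≡⟨ ++-assoc p (n + x ∷ map (n +_) q) [ n + y ] ⟩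
  p ++ n + x ∷ map (n +_) q ++ [ n + y ]   ≡⟨ cong (λ r → p ++ n + x ∷ r) (map-++ (n +_) q [ y ]) ⟨
  p ++ n + x ∷ map (n +_) (q ∷ʳ y)        ∎
  where open ≡-Reasoning

-- The edge into the next block is part of the path but its endpoint is not in the list, so that the
-- paths of two adjacent blocks concatenate to a path of the double block.
record BlockPath (d : ℕ) (a b : Bool) (p : List ℕ) : Set where
  field
    starts : head p ≡ just (bit a)
    inside : All (_< width d) p
    short  : length p ≤ width d
    linked : Linked (Edge (suc d)) (p ∷ʳ (width d + bit b))
open BlockPath

compose : ∀ {d a m b p q} → BlockPath d a m p → BlockPath d m b q →
  BlockPath (suc d) a b (joinAt (width d) p q)
compose {p = []} record { starts = () } _
compose {q = []} _ record { starts = () }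
compose {d} {a} {m} {b} {x ∷ p} {y ∷ q} P Q@record { starts = refl } = record
  { starts = starts P
  ; inside = subst (λ n → All (_< n) (joinAt N (x ∷ p) (y ∷ q))) (sym (width-suc d))
      (All.++⁺ (All.map (λ z<N → <-≤-trans z<N (m≤m+n N N)) (inside P))
               (All.map⁺ (All.map (+-monoʳ-< N) (inside Q))))
  ; short = begin
      length (joinAt N (x ∷ p) (y ∷ q))           ≡⟨ length-++ (x ∷ p) ⟩
      length (x ∷ p) + length (map (N +_) (y ∷ q)) ≡⟨ cong (length (x ∷ p) +_) (length-map (N +_) (y ∷ q)) ⟩
      length (x ∷ p) + length (y ∷ q)             ≤⟨ +-mono-≤ (short P) (short Q) ⟩
      N + N                                       ≡⟨ width-suc d ⟨
      width (suc d)                               ∎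
  ; linked = subst (Linked (Edge (suc (suc d)))) (sym endpoint)
      (Linked-join (x ∷ p) (Linked.map (Edge-mono (n≤1+n _)) (linked P))
        (Linked.map (Edge-mono (n≤1+n _)) (Linked-shift N ∣-refl (linked Q))))
  }
  where
  N = width d
  open ≤-Reasoning
  endpoint : joinAt N (x ∷ p) (y ∷ q) ∷ʳ (width (suc d) + bit b)
           ≡ (x ∷ p) ++ N + y ∷ map (N +_) (q ∷ʳ (N + bit b))
  endpoint = trans (cong (λ z → joinAt N (x ∷ p) (y ∷ q) ∷ʳ z)
                         (trans (cong (_+ bit b) (width-suc d)) (+-assoc N N (bit b))))
                   (joinAt-∷ʳ N (x ∷ p) y q (N + bit b))

Edge-top : ∀ L c → Edge L (bit c) (2 ^ L + bit c)
Edge-top L false = subst (Edge L 0) (sym (+-identityʳ (2 ^ L))) (edge ≤-refl (aligned (divides 0 refl)))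
Edge-top L true  = subst (Edge L 1) (+-comm 1 (2 ^ L)) (edge ≤-refl (aligned′ (divides 0 refl)))

Edge-0-1 : ∀ {L} → Edge L 0 1
Edge-0-1 = edge z≤n (aligned (divides 0 refl))

Edge-1-2 : ∀ {L} → Edge L 1 2
Edge-1-2 = edge z≤n (aligned (divides 1 refl))

-- The paths of block d + 1 that leave it by a single edge of level d + 2.
topLevelPaths : Bool → Bool → List (List ℕ)
topLevelPaths false false = [ 0 ∷ [] ]
topLevelPaths false true  = [ 0 ∷ 1 ∷ [] ]
topLevelPaths true  false = []
topLevelPaths true  true  = [ 1 ∷ [] ]

mutual
  blockPaths : ℕ → Bool → Bool → List (List ℕ)
  blockPaths zero    false false = (0 ∷ 1 ∷ []) ∷ (0 ∷ []) ∷ []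
  blockPaths zero    false true  = [ 0 ∷ 1 ∷ [] ]
  blockPaths zero    true  _     = [ 1 ∷ [] ]
  blockPaths (suc d) a     b     = blockPathsVia d a false b ++ blockPathsVia d a true b ++ topLevelPaths a b

  blockPathsVia : ℕ → Bool → Bool → Bool → List (List ℕ)
  blockPathsVia d a m b = cartesianProductWith (joinAt (width d)) (blockPaths d a m) (blockPaths d m b)

topLevelPaths-BlockPath : ∀ d a b {p} → p ∈ topLevelPaths a b → BlockPath (suc d) a b p
topLevelPaths-BlockPath d false false (here refl) = record
  { starts = refl ; inside = ≤-trans (s≤s z≤n) (2≤width (suc d)) ∷ []
  ; short = ≤-trans (s≤s z≤n) (2≤width (suc d)) ; linked = Edge-top _ false ∷ [-] }
topLevelPaths-BlockPath d false true (here refl) = record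
  { starts = refl ; inside = ≤-trans (s≤s z≤n) (2≤width (suc d)) ∷ 2≤width (suc d) ∷ []
  ; short = 2≤width (suc d) ; linked = Edge-0-1 ∷ Edge-top _ true ∷ [-] }
topLevelPaths-BlockPath d true true (here refl) = record
  { starts = refl ; inside = 2≤width (suc d) ∷ []
  ; short = ≤-trans (s≤s z≤n) (2≤width (suc d)) ; linked = Edge-top _ true ∷ [-] }

blockPathsVia-BlockPath : ∀ d a m b {p} → p ∈ blockPathsVia d a m b → BlockPath (suc d) a b p
blockPaths-BlockPath : ∀ d a b {p} → p ∈ blockPaths d a b → BlockPath d a b p

blockPathsVia-BlockPath d a m b v∈
  with _ , _ , p∈ , q∈ , refl ← ∈-cartesianProductWith⁻ (joinAt (width d)) (blockPaths d a m) (blockPaths d m b) v∈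
  = compose (blockPaths-BlockPath d a m p∈) (blockPaths-BlockPath d m b q∈)

blockPaths-BlockPath zero false false (here refl) = record
  { starts = refl ; inside = s≤s z≤n ∷ s≤s (s≤s z≤n) ∷ [] ; short = ≤-refl
  ; linked = Edge-0-1 ∷ Edge-1-2 ∷ [-] }
blockPaths-BlockPath zero false false (there (here refl)) = record
  { starts = refl ; inside = s≤s z≤n ∷ [] ; short = s≤s z≤n ; linked = Edge-top 1 false ∷ [-] }
blockPaths-BlockPath zero false true (here refl) = record
  { starts = refl ; inside = s≤s z≤n ∷ s≤s (s≤s z≤n) ∷ [] ; short = ≤-refl
  ; linked = Edge-0-1 ∷ Edge-top 1 true ∷ [-] }
blockPaths-BlockPath zero true false (here refl) = record
  { starts = refl ; inside = s≤s (s≤s z≤n) ∷ [] ; short = s≤s z≤n ; linked = Edge-1-2 ∷ [-] }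
blockPaths-BlockPath zero true true (here refl) = record
  { starts = refl ; inside = s≤s (s≤s z≤n) ∷ [] ; short = s≤s z≤n ; linked = Edge-top 1 true ∷ [-] }
blockPaths-BlockPath (suc d) a b p∈ with ∈-++⁻ (blockPathsVia d a false b) p∈
... | inj₁ p∈via = blockPathsVia-BlockPath d a false b p∈via
... | inj₂ p∈rest with ∈-++⁻ (blockPathsVia d a true b) p∈rest
...   | inj₁ p∈via = blockPathsVia-BlockPath d a true b p∈via
...   | inj₂ p∈top = topLevelPaths-BlockPath d a b p∈top

topLevelPaths-< : ∀ a b {p} → p ∈ topLevelPaths a b → All (_< 2) p
topLevelPaths-< false false (here refl) = s≤s z≤n ∷ []
topLevelPaths-< false true  (here refl) = s≤s z≤n ∷ s≤s (s≤s z≤n) ∷ []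
topLevelPaths-< true  true  (here refl) = s≤s (s≤s z≤n) ∷ []

topLevelPaths-unique : ∀ a b → Unique (topLevelPaths a b)
topLevelPaths-unique false false = [] ∷ []
topLevelPaths-unique false true  = [] ∷ []
topLevelPaths-unique true  false = []
topLevelPaths-unique true  true  = [] ∷ []

blockPaths-unique : ∀ d a b → Unique (blockPaths d a b)
blockPaths-unique zero    false false = ((λ ()) ∷ []) ∷ [] ∷ []
blockPaths-unique zero    false true  = [] ∷ []
blockPaths-unique zero    true  false = [] ∷ []
blockPaths-unique zero    true  true  = [] ∷ []
blockPaths-unique (suc d) a b =
  Unique.++⁺ (via-unique false)
    (Unique.++⁺ (via-unique true) (topLevelPaths-unique a b) (via-disjoint-top true))
    via-disjoint-rest
  where
  N = width d

  inside∈ : ∀ {a m p} → p ∈ blockPaths d a m → All (_< N) p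
  inside∈ {a} {m} = inside ∘′ blockPaths-BlockPath d a m

  starts∈ : ∀ {m b q} → q ∈ blockPaths d m b → head q ≡ just (bit m)
  starts∈ {m} {b} = starts ∘′ blockPaths-BlockPath d m b

  ∈-via⁻ : ∀ m {v} → v ∈ blockPathsVia d a m b →
    ∃₂ λ p q → p ∈ blockPaths d a m × q ∈ blockPaths d m b × v ≡ joinAt N p q
  ∈-via⁻ m = ∈-cartesianProductWith⁻ (joinAt N) (blockPaths d a m) (blockPaths d m b)

  via-unique : ∀ m → Unique (blockPathsVia d a m b)
  via-unique m = Unique-cartesianProductWith⁺ (joinAt N)
    (λ p∈ p′∈ → ++-map-+-injective _ _ (inside∈ p∈) (inside∈ p′∈)) (blockPaths-unique d a m) (blockPaths-unique d m b)

  -- A path through the middle visits N + bit m ≥ 2, while the top-level paths stay below 2.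
  via-disjoint-top : ∀ m {v} → ¬ (v ∈ blockPathsVia d a m b × v ∈ topLevelPaths a b)
  via-disjoint-top m (v∈via , v∈top) with p , q , _ , q∈ , refl ← ∈-via⁻ m v∈via
    with y ∷ _ ← q | refl ← starts∈ q∈
    = <⇒≱ (All.head (All.++⁻ʳ p (topLevelPaths-< a b v∈top))) (≤-trans (2≤width d) (m≤m+n N y))

  -- The two kinds of paths through the middle cross it at different vertices.
  via-disjoint-rest : ∀ {v} →
    ¬ (v ∈ blockPathsVia d a false b × v ∈ blockPathsVia d a true b ++ topLevelPaths a b)
  via-disjoint-rest (v∈via , v∈rest) with ∈-++⁻ (blockPathsVia d a true b) v∈rest
  ... | inj₂ v∈top = via-disjoint-top false (v∈via , v∈top)
  ... | inj₁ v∈via′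
    with p , q , p∈ , q∈ , refl ← ∈-via⁻ false v∈via
    with p′ , q′ , p′∈ , q′∈ , e ← ∈-via⁻ true v∈via′
    with _ , refl ← ++-map-+-injective p p′ (inside∈ p∈) (inside∈ p′∈) e
    with () ← trans (sym (starts∈ q∈)) (starts∈ q′∈)

-- The length of blockPaths d a b, computed without building the lists.
pathCount : ℕ → Bool → Bool → ℕ
pathCount zero    a b = length (blockPaths zero a b)
pathCount (suc d) a b = pathCount d a false * pathCount d false b
                      + (pathCount d a true * pathCount d true b + length (topLevelPaths a b))

length-blockPaths : ∀ d a b → length (blockPaths d a b) ≡ pathCount d a b
length-blockPaths zero    a b = refl
length-blockPaths (suc d) a b = begin
  length (blockPathsVia d a false b ++ blockPathsVia d a true b ++ topLevelPaths a b)
    ≡⟨ length-++ (blockPathsVia d a false b) ⟩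
  length (blockPathsVia d a false b) + length (blockPathsVia d a true b ++ topLevelPaths a b)
    ≡⟨ cong (length (blockPathsVia d a false b) +_) (length-++ (blockPathsVia d a true b)) ⟩
  length (blockPathsVia d a false b) + (length (blockPathsVia d a true b) + length (topLevelPaths a b))
    ≡⟨ cong₂ (λ x y → x + (y + length (topLevelPaths a b))) (length-via false) (length-via true) ⟩
  pathCount (suc d) a b ∎
  where
  open ≡-Reasoning
  length-via : ∀ m → length (blockPathsVia d a m b) ≡ pathCount d a m * pathCount d m b
  length-via m = trans (length-cartesianProductWith (joinAt (width d)) (blockPaths d a m) (blockPaths d m b))
                       (cong₂ _*_ (length-blockPaths d a m) (length-blockPaths d m b))

Matrix : Set
Matrix = Bool → Bool → ℕ

Square≤ : Matrix → Matrix → Set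
Square≤ M N = ∀ a b → M a false * M false b + M a true * M true b ≤ N a b

-- For positive v this bounds the spectral radius of M below by P / W (Collatz–Wielandt).
EigenLowerBound : Matrix → (Bool → ℕ) → ℕ → ℕ → Set
EigenLowerBound M v P W = ∀ a → P * v a ≤ W * (M a false * v false + M a true * v true)

EigenLowerBound-square : ∀ {M N v P W} → Square≤ M N → EigenLowerBound M v P W →
  EigenLowerBound N v (P * P) (W * W)
EigenLowerBound-square {M} {N} {v} {P} {W} M²≤N Mv≥λv a = begin
  P * P * v a
    ≡⟨ *-assoc P P (v a) ⟩
  P * (P * v a)
    ≤⟨ *-monoʳ-≤ P (Mv≥λv a) ⟩
  P * (W * (M a false * v false + M a true * v true))
    ≡⟨ move-inside P W (M a false) (M a true) (v false) (v true) ⟩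
  W * (M a false * (P * v false) + M a true * (P * v true))
    ≤⟨ *-monoʳ-≤ W (+-mono-≤ (*-monoʳ-≤ (M a false) (Mv≥λv false)) (*-monoʳ-≤ (M a true) (Mv≥λv true))) ⟩
  W * (M a false * (W * (M false false * v false + M false true * v true))
     + M a true * (W * (M true false * v false + M true true * v true)))
    ≡⟨ expand W (M a false) (M a true) (M false false) (M false true) (M true false) (M true true)
              (v false) (v true) ⟩
  W * W * ((M a false * M false false + M a true * M true false) * v false
         + (M a false * M false true + M a true * M true true) * v true)
    ≤⟨ *-monoʳ-≤ (W * W) (+-mono-≤ (*-monoˡ-≤ (v false) (M²≤N a false)) (*-monoˡ-≤ (v true) (M²≤N a true))) ⟩
  W * W * (N a false * v false + N a true * v true) ∎
  where
  open ≤-Reasoning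
  move-inside : ∀ P W a₀ a₁ v₀ v₁ → P * (W * (a₀ * v₀ + a₁ * v₁)) ≡ W * (a₀ * (P * v₀) + a₁ * (P * v₁))
  move-inside = solve-∀
  expand : ∀ W a₀ a₁ b₀₀ b₀₁ b₁₀ b₁₁ v₀ v₁ →
    W * (a₀ * (W * (b₀₀ * v₀ + b₀₁ * v₁)) + a₁ * (W * (b₁₀ * v₀ + b₁₁ * v₁)))
    ≡ W * W * ((a₀ * b₀₀ + a₁ * b₁₀) * v₀ + (a₀ * b₀₁ + a₁ * b₁₁) * v₁)
  expand = solve-∀

pathCount-square≤ : ∀ d → Square≤ (pathCount d) (pathCount (suc d))
pathCount-square≤ d a b = +-monoʳ-≤ (pathCount d a false * pathCount d false b) (m≤m+n _ _)

^-width-suc : ∀ x d → x ^ width (suc d) ≡ x ^ width d * x ^ width d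
^-width-suc x d = trans (cong (x ^_) (width-suc d)) (^-distribˡ-+-* x (width d) (width d))

-- Approximately the Perron eigenvector of pathCount 4, which satisfies the base case of
-- pathCount-growth by evaluation.
perronWeight : Bool → ℕ
perronWeight false = 16
perronWeight true  = 9

pathCount-growth : ∀ m → EigenLowerBound (pathCount (4 + m)) perronWeight
                                         (17003 ^ width (4 + m)) (10000 ^ width (4 + m))
pathCount-growth zero false = ≤ᵇ⇒≤ _ _ _
pathCount-growth zero true  = ≤ᵇ⇒≤ _ _ _
pathCount-growth (suc m) =
  subst₂ (EigenLowerBound (pathCount (5 + m)) perronWeight)
    (sym (^-width-suc 17003 (4 + m))) (sym (^-width-suc 10000 (4 + m)))
    (EigenLowerBound-square {pathCount (4 + m)} {pathCount (5 + m)} {perronWeight}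
      {17003 ^ width (4 + m)} {10000 ^ width (4 + m)} (pathCount-square≤ (4 + m)) (pathCount-growth m))

pathCount-lowerBound : ∀ m → 17003 ^ width (4 + m)
  ≤ 10000 ^ width (4 + m) * (pathCount (4 + m) false false + pathCount (4 + m) false true)
pathCount-lowerBound m = *-cancelʳ-≤ _ _ 16 (begin
  P * 16                      ≤⟨ pathCount-growth m false ⟩
  W * (y₀ * 16 + y₁ * 9)      ≤⟨ *-monoʳ-≤ W (+-monoʳ-≤ (y₀ * 16) (*-monoʳ-≤ y₁ (m≤m+n 9 7))) ⟩
  W * (y₀ * 16 + y₁ * 16)     ≡⟨ cong (W *_) (*-distribʳ-+ 16 y₀ y₁) ⟨
  W * ((y₀ + y₁) * 16)        ≡⟨ *-assoc W (y₀ + y₁) 16 ⟨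
  W * (y₀ + y₁) * 16          ∎)
  where
  open ≤-Reasoning
  P = 17003 ^ width (4 + m)
  W = 10000 ^ width (4 + m)
  y₀ = pathCount (4 + m) false false
  y₁ = pathCount (4 + m) false true

record IsPath (ℓ : ℕ) (xs : List ℕ) : Set where
  field
    linked     : Linked (Edge ℓ) xs
    bounded    : All (_< nV ℓ) xs
    nontrivial : 2 ≤ length xs
    fits       : length xs ≤ suc (nV ℓ)

BlockPath⇒IsPath : ∀ {d a b p} → BlockPath d a b p → IsPath (suc d) (p ∷ʳ (width d + bit b))
BlockPath⇒IsPath {p = []} record { starts = () }
BlockPath⇒IsPath {d} {a} {b} {x ∷ p} P = record
  { linked     = linked P
  ; bounded    = All.++⁺ (All.map (λ y<N → <-≤-trans y<N (m≤m+n N 2)) (inside P))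
                         (+-monoʳ-< N (bit<2 b) ∷ [])
  ; nontrivial = subst (2 ≤_) (sym length-∷ʳ) (s≤s (s≤s z≤n))
  ; fits       = subst (_≤ suc (nV (suc d))) (sym length-∷ʳ) (s≤s (≤-trans (short P) (m≤m+n N 2)))
  }
  where
  N = width d
  bit<2 : ∀ c → bit c < 2
  bit<2 false = s≤s z≤n
  bit<2 true  = s≤s (s≤s z≤n)
  length-∷ʳ : length ((x ∷ p) ∷ʳ (N + bit b)) ≡ suc (length (x ∷ p))
  length-∷ʳ = trans (length-++ (x ∷ p)) (+-comm (length (x ∷ p)) 1)

-- Since nV (suc d) = width d + 2, these end at the last vertex but one or at the last vertex.
pathsToEnd : ℕ → Bool → List (List ℕ)
pathsToEnd d b = map (_∷ʳ (width d + bit b)) (blockPaths d false b)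

wholePaths : ℕ → List (List ℕ)
wholePaths d = pathsToEnd d false ++ pathsToEnd d true

wholePaths-IsPath : ∀ d {xs} → xs ∈ wholePaths d → IsPath (suc d) xs
wholePaths-IsPath d xs∈ with ∈-++⁻ (pathsToEnd d false) xs∈
... | inj₁ xs∈end with _ , p∈ , refl ← ∈-map⁻ _ xs∈end =
  BlockPath⇒IsPath (blockPaths-BlockPath d false false p∈)
... | inj₂ xs∈end with _ , p∈ , refl ← ∈-map⁻ _ xs∈end =
  BlockPath⇒IsPath (blockPaths-BlockPath d false true p∈)

wholePaths-unique : ∀ d → Unique (wholePaths d)
wholePaths-unique d = Unique.++⁺ (end-unique false) (end-unique true) ends-disjoint
  where
  end-unique : ∀ b → Unique (pathsToEnd d b)
  end-unique b = Unique.map⁺ (λ {xs} {ys} e → proj₁ (∷ʳ-injective xs ys e)) (blockPaths-unique d false b)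
  ends-disjoint : ∀ {xs} → ¬ (xs ∈ pathsToEnd d false × xs ∈ pathsToEnd d true)
  ends-disjoint (xs∈₀ , xs∈₁)
    with p , _ , refl ← ∈-map⁻ _ xs∈₀
    with q , _ , e ← ∈-map⁻ _ xs∈₁
    with () ← +-cancelˡ-≡ (width d) 0 1 (proj₂ (∷ʳ-injective p q e))

length-wholePaths : ∀ d → length (wholePaths d) ≡ pathCount d false false + pathCount d false true
length-wholePaths d = trans (length-++ (pathsToEnd d false)) (cong₂ _+_ (length-end false) (length-end true))
  where
  length-end : ∀ b → length (pathsToEnd d b) ≡ pathCount d false b
  length-end b = trans (length-map _ (blockPaths d false b)) (length-blockPaths d false b)

T-does : {P : Set} (P? : Dec P) → P → T (does P?)
T-does P? p = subst T (sym (dec-true P? p)) tt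

edgeAt-complete : ∀ {j x} → Source j x → T (edgeAt x (x + 2 ^ j) j)
edgeAt-complete {j} {x} src =
  Equivalence.from T-∧ (≡⇒≡ᵇ (x + 2 ^ j) (x + 2 ^ j) refl , Equivalence.from T-∨ (from-source src))
  where
  from-source : ∀ {x} → Source j x → T (does (2 ^ j ∣? x)) ⊎ T ((1 ≤ᵇ x) ∧ does (2 ^ j ∣? (x ∸ 1)))
  from-source (aligned  j∣x) = inj₁ (T-does (2 ^ j ∣? _) j∣x)
  from-source (aligned′ j∣x) = inj₂ (T-does (2 ^ j ∣? _) j∣x)

0<nV : ∀ ℓ → 0 < nV ℓ
0<nV ℓ = ≤-trans (s≤s z≤n) (m≤n+m 2 (2 ^ ℓ))

0<q-p : ∀ {p q : ℚ} → p ℚ.< q → 0ℚ ℚ.< q ℚ.- p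
0<q-p {p} {q} p<q = subst (ℚ._< q ℚ.- p) (ℚ.+-inverseʳ p) (ℚ.+-monoˡ-< (ℚ.- p) p<q)

∈-listsOfLength : ∀ {m} (xs : List (Fin m)) → xs ∈ listsOfLength m (length xs)
∈-listsOfLength []           = here refl
∈-listsOfLength {m} (x ∷ xs) = ∈-concatMap⁺ (λ v → map (v ∷_) (listsOfLength m (length xs)))
  (lose (∈-allFin x) (∈-map⁺ (x ∷_) (∈-listsOfLength xs)))

∈-candidates : ∀ {m} x y (zs : List (Fin m)) → length zs < m → x ∷ y ∷ zs ∈ candidates m
∈-candidates {m} x y zs zs<m = ∈-concatMap⁺ (λ k → listsOfLength m (suc (suc (toℕ k))))
  (lose (∈-allFin (fromℕ< zs<m))
    (subst (λ k → x ∷ y ∷ zs ∈ listsOfLength m (suc (suc k))) (sym (toℕ-fromℕ< zs<m))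
      (∈-listsOfLength (x ∷ y ∷ zs))))

module XOrdered (ℓ : ℕ) (pos : Fin (nV ℓ) → Point)
                (x-increasing : ∀ i j → toℕ i < toℕ j → xc (pos i) ℚ.< xc (pos j)) where

  instance
    nV-nonZero : NonZero (nV ℓ)
    nV-nonZero = >-nonZero (0<nV ℓ)

  vertex : ℕ → Fin (nV ℓ)
  vertex x = x mod nV ℓ

  toℕ-vertex : ∀ {x} → x < nV ℓ → toℕ (vertex x) ≡ x
  toℕ-vertex {x} x<n = trans (toℕ-fromℕ< (m%n<n x (nV ℓ))) (m<n⇒m%n≡m x<n)

  edgeᵇ-complete : ∀ {x y} → Edge ℓ x y → x < nV ℓ → y < nV ℓ → T (edgeᵇ ℓ (vertex x) (vertex y))
  edgeᵇ-complete {x} {y} (edge {j} j≤ℓ src) x<n y<n =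
    subst₂ (λ u v → T (any (λ k → edgeAt u v (toℕ k)) (allFin (suc ℓ))))
      (sym (toℕ-vertex x<n)) (sym (toℕ-vertex y<n))
      (any⁺ _ (lose (∈-allFin (fromℕ< (s≤s j≤ℓ)))
        (subst (λ k → T (edgeAt x y k)) (sym (toℕ-fromℕ< (s≤s j≤ℓ))) (edgeAt-complete src))))

  isMonotonePathᵇ-complete : ∀ {x xs} → Linked (Edge ℓ) (x ∷ xs) → All (_< nV ℓ) (x ∷ xs) →
    T (isMonotonePathᵇ ℓ pos (map vertex (x ∷ xs)))
  isMonotonePathᵇ-complete [-] _ = tt
  isMonotonePathᵇ-complete {x} {y ∷ _} (e ∷ es) (x<n ∷ y<n ∷ rest) = Equivalence.from T-∧
    ( Equivalence.from T-∨ (inj₁ (edgeᵇ-complete e x<n y<n))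
    , Equivalence.from T-∧ ( T-does (_ ℚ.>? 0ℚ) (0<q-p (x-increasing _ _ vertex-<))
                           , isMonotonePathᵇ-complete es (y<n ∷ rest)))
    where
    vertex-< : toℕ (vertex x) < toℕ (vertex y)
    vertex-< = subst₂ _<_ (sym (toℕ-vertex x<n)) (sym (toℕ-vertex y<n)) (Edge⇒< e)

  IsPath⇒counted : ∀ {xs} → IsPath ℓ xs → map vertex xs ∈ filterᵇ (isMonotonePathᵇ ℓ pos) (candidates (nV ℓ))
  IsPath⇒counted {[]}     record { nontrivial = () }
  IsPath⇒counted {_ ∷ []} record { nontrivial = s≤s () }
  IsPath⇒counted {x ∷ y ∷ zs} P = ∈-filter⁺ _
    (∈-candidates _ _ _ (subst (_< nV ℓ) (sym (length-map vertex zs)) (s≤s⁻¹ (IsPath.fits P))))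
    (isMonotonePathᵇ-complete (IsPath.linked P) (IsPath.bounded P))

  countMonotonePaths-≥ : ∀ {xss} → Unique xss → (∀ {xs} → xs ∈ xss → IsPath ℓ xs) →
    length xss ≤ countMonotonePaths ℓ pos
  countMonotonePaths-≥ {xss} xss! paths =
    subst (_≤ countMonotonePaths ℓ pos) (length-map (map vertex) xss) (Unique-⊆⇒length≤ vertices! counted)
    where
    roundtrip : map (map toℕ) (map (map vertex) xss) ≡ xss
    roundtrip = trans (sym (map-∘ xss)) (map-id-local (All.tabulate λ xs∈ →
      trans (sym (map-∘ _)) (map-id-local (All.map toℕ-vertex (IsPath.bounded (paths xs∈))))))
    vertices! : Unique (map (map vertex) xss)
    vertices! = Unique.map⁻ (subst Unique (sym roundtrip) xss!)
    counted : ∀ {ws} → ws ∈ map (map vertex) xss → ws ∈ filterᵇ (isMonotonePathᵇ ℓ pos) (candidates (nV ℓ))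
    counted ws∈ with xs , xs∈ , refl ← ∈-map⁻ (map vertex) ws∈ = IsPath⇒counted (paths xs∈)

powᵘ : ℚᵘ → ℕ → ℚᵘ
powᵘ r zero    = ℚᵘ.1ℚᵘ
powᵘ r (suc n) = r ℚᵘ.* powᵘ r n

toℚᵘ-^ℚ : ∀ q n → toℚᵘ (q ^ℚ n) ℚᵘ.≃ powᵘ (toℚᵘ q) n
toℚᵘ-^ℚ q zero    = ℚᵘ.≃-refl
toℚᵘ-^ℚ q (suc n) = ℚᵘ.≃-trans (ℚ.toℚᵘ-homo-* q (q ^ℚ n)) (ℚᵘ.*-congˡ {toℚᵘ q} (toℚᵘ-^ℚ q n))

↥-* : ∀ r t → ↥ (r ℚᵘ.* t) ≡ ↥ r ℤ.* ↥ t
↥-* (mkℚᵘ _ _) (mkℚᵘ _ _) = refl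

↧ₙ-* : ∀ r t → ↧ₙ (r ℚᵘ.* t) ≡ ↧ₙ r * ↧ₙ t
↧ₙ-* (mkℚᵘ _ _) (mkℚᵘ _ _) = refl

↥-powᵘ : ∀ p s n → ↥ powᵘ (mkℚᵘ (ℤ.+ p) s) n ≡ ℤ.+ (p ^ n)
↥-powᵘ p s zero    = refl
↥-powᵘ p s (suc n) = trans (↥-* (mkℚᵘ (ℤ.+ p) s) (powᵘ _ n))
  (trans (cong (ℤ.+ p ℤ.*_) (↥-powᵘ p s n)) (sym (ℤ.pos-* p (p ^ n))))

↧ₙ-powᵘ : ∀ r n → ↧ₙ powᵘ r n ≡ ↧ₙ r ^ n
↧ₙ-powᵘ r zero    = refl
↧ₙ-powᵘ r (suc n) = trans (↧ₙ-* r (powᵘ r n)) (cong (↧ₙ r *_) (↧ₙ-powᵘ r n))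

scaledPower-≤ : ∀ {c q : ℚ} {u K p Q} .{{_ : NonZero K}} .{{_ : NonZero Q}} →
  toℚᵘ c ≡ ℤ.+ u ℚᵘ./ K → toℚᵘ q ≡ ℤ.+ p ℚᵘ./ Q →
  ∀ n C → u * p ^ n ≤ C * (K * Q ^ n) → c ℚ.* q ^ℚ n ℚ.≤ ℕtoℚ C
scaledPower-≤ {c} {q} {u} {suc k} {p} {suc s} c≡ q≡ n C bound = ℚ.toℚᵘ-cancel-≤
  (ℚᵘ.≤-respʳ-≃ (ℚᵘ.≃-sym (ℚ.toℚᵘ-fromℚᵘ (mkℚᵘ (ℤ.+ C) 0)))
    (ℚᵘ.≤-respˡ-≃ (ℚᵘ.≃-sym lhs≃) (*≤* (subst₂ ℤ._≤_ (sym numerator) (sym denominator) (ℤ.+≤+ bound)))))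
  where
  L = mkℚᵘ (ℤ.+ u) k ℚᵘ.* powᵘ (mkℚᵘ (ℤ.+ p) s) n
  lhs≃ : toℚᵘ (c ℚ.* q ^ℚ n) ℚᵘ.≃ L
  lhs≃ = ℚᵘ.≃-trans (ℚ.toℚᵘ-homo-* c (q ^ℚ n))
           (subst₂ (λ x y → toℚᵘ c ℚᵘ.* toℚᵘ (q ^ℚ n) ℚᵘ.≃ x ℚᵘ.* y) c≡ (cong (λ r → powᵘ r n) q≡)
             (ℚᵘ.*-congˡ {toℚᵘ c} (toℚᵘ-^ℚ q n)))
  numerator : ↥ L ℤ.* ℤ.+ 1 ≡ ℤ.+ (u * p ^ n)
  numerator = begin
    ↥ L ℤ.* ℤ.+ 1                       ≡⟨ ℤ.*-identityʳ (↥ L) ⟩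
    ↥ L                                 ≡⟨ ↥-* (mkℚᵘ (ℤ.+ u) k) (powᵘ _ n) ⟩
    ℤ.+ u ℤ.* ↥ powᵘ (mkℚᵘ (ℤ.+ p) s) n ≡⟨ cong (ℤ.+ u ℤ.*_) (↥-powᵘ p s n) ⟩
    ℤ.+ u ℤ.* ℤ.+ (p ^ n)               ≡⟨ ℤ.pos-* u (p ^ n) ⟨
    ℤ.+ (u * p ^ n)                     ∎
    where open ≡-Reasoning
  denominator : ℤ.+ C ℤ.* ↧ L ≡ ℤ.+ (C * (suc k * suc s ^ n))
  denominator = trans
    (cong (λ m → ℤ.+ C ℤ.* ℤ.+ m)
      (trans (↧ₙ-* (mkℚᵘ (ℤ.+ u) k) (powᵘ _ n)) (cong (suc k *_) (↧ₙ-powᵘ (mkℚᵘ (ℤ.+ p) s) n))))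
    (sym (ℤ.pos-* C _))

^-bound-shift : ∀ a b w k C → .{{NonZero b}} → a ^ w ≤ b ^ w * C →
  1 * a ^ (w + k) ≤ C * (a ^ k * b ^ (w + k))
^-bound-shift a b w k C aʷ≤bʷC = begin
  1 * a ^ (w + k)               ≡⟨ *-identityˡ (a ^ (w + k)) ⟩
  a ^ (w + k)                   ≡⟨ ^-distribˡ-+-* a w k ⟩
  a ^ w * a ^ k                 ≤⟨ *-monoˡ-≤ (a ^ k) aʷ≤bʷC ⟩
  b ^ w * C * a ^ k             ≤⟨ *-monoˡ-≤ (a ^ k) (m≤m*n (b ^ w * C) (b ^ k) {{m^n≢0 b k}}) ⟩
  b ^ w * C * b ^ k * a ^ k     ≡⟨ regroup (b ^ w) C (b ^ k) (a ^ k) ⟩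
  C * (a ^ k * (b ^ w * b ^ k)) ≡⟨ cong (λ x → C * (a ^ k * x)) (^-distribˡ-+-* b w k) ⟨
  C * (a ^ k * b ^ (w + k))     ∎
  where
  open ≤-Reasoning
  regroup : ∀ x y z t → x * y * z * t ≡ y * (t * (x * z))
  regroup = solve-∀

scale : ℚ
scale = ℤ.+ 1 ℚ./ (17003 ^ 2)

scale-bound : ∀ ℓ C → 17003 ^ 2 ^ ℓ ≤ 10000 ^ 2 ^ ℓ * C → scale ℚ.* base ^ℚ nV ℓ ℚ.≤ ℕtoℚ C
scale-bound ℓ C = scaledPower-≤ {K = 17003 ^ 2} {Q = 10000} refl refl (nV ℓ) C
  ∘′ ^-bound-shift 17003 10000 (2 ^ ℓ) 2 C

countMonotonePaths-lowerBound : ∀ ℓ → 5 ≤ ℓ → (pos : Fin (nV ℓ) → Point) →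
  (∀ i j → toℕ i < toℕ j → xc (pos i) ℚ.< xc (pos j)) →
  17003 ^ 2 ^ ℓ ≤ 10000 ^ 2 ^ ℓ * countMonotonePaths ℓ pos
countMonotonePaths-lowerBound ℓ 5≤ℓ pos x-increasing with m , refl ← m≤n⇒∃[o]m+o≡n 5≤ℓ = begin
  17003 ^ width d                                                      ≤⟨ pathCount-lowerBound m ⟩
  10000 ^ width d * (pathCount d false false + pathCount d false true)
    ≡⟨ cong (10000 ^ width d *_) (length-wholePaths d) ⟨
  10000 ^ width d * length (wholePaths d)                              ≤⟨ *-monoʳ-≤ (10000 ^ width d) counted ⟩
  10000 ^ width d * countMonotonePaths (suc d) pos                     ∎
  where
  open ≤-Reasoning
  d = 4 + m
  counted : length (wholePaths d) ≤ countMonotonePaths (suc d) pos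
  counted = XOrdered.countMonotonePaths-≥ (suc d) pos x-increasing (wholePaths-unique d) (wholePaths-IsPath d)

theorem1 : Σ ℚ λ c → (0ℚ ℚ.< c) × Σ ℕ λ L →
    ∀ (ℓ : ℕ) → 1 ≤ ℓ → L ≤ ℓ → (pos : Fin (nV ℓ) → Point) →
    IsXOrderedPlaneEmbedding ℓ pos →
    (c ℚ.* (base ^ℚ nV ℓ)) ℚ.≤ ℕtoℚ (countMonotonePaths ℓ pos)
theorem1 = scale , ℚ.positive⁻¹ scale , 5 , λ ℓ _ 5≤ℓ pos (x-increasing , _) →
  scale-bound ℓ _ (countMonotonePaths-lowerBound ℓ 5≤ℓ pos x-increasing)
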